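{- Let $n$, $a$, $k_1$, $k_2$ be integers with $k_1,k_2\ge 0$, $n=k_1(a+1)+k_2(a-1)$, $6\le a\le\left\lfloor\frac{n}{2}\right\rfloor$, and $a$ even. Then $$\beta_b(C(n;1,a))\ge k_1\,\frac{a}{2}+k_2\left(\frac{a}{2}-1\right).$$
   Context: For integers $n\ge 3$ and $1\le a\le\lfloor n/2\rfloor$, the circulant graph $C(n;1,a)$ has vertex set $\{v_0,\dots,v_{n-1}\}$ and edges $v_iv_{i+1}$ and $v_iv_{i+a}$, subscripts modulo $n$. For a connected graph $G$, a broadcast is a function $f:V(G)\to\{0,\dots,\mathrm{diam}(G)\}$ with $f(v)\le e(v)$ (eccentricity) for all $v$; $V_f^+=\{v:f(v)>0\}$. $f$ is independent if $d(u,v)>\max\{f(u),f(v)\}$ for all distinct $u,v\in V_f^+$. The cost is $\sigma(f)=\sum_v f(v)$, and $\beta_b(G)$ is the maximum cost of an independent broadcast on $G$. -}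

module Defs where

open import Data.Nat using (ℕ; zero; suc; _+_; _∸_; _⊔_; _≤_; _<_)
open import Data.Fin using (Fin; toℕ)
open import Data.List using (map; allFin)
open import Data.Nat.ListAction using (sum)
open import Data.Sum using (_⊎_)
open import Data.Product using (∃-syntax; _×_)
open import Relation.Binary.PropositionalEquality using (_≡_)
open import Relation.Nullary using (¬_)

Shift : (n d : ℕ) → Fin n → Fin n → Set
Shift n d u v = (toℕ u + d ≡ toℕ v) ⊎ (toℕ u + d ≡ toℕ v + n)

Adj : (n a : ℕ) → Fin n → Fin n → Set
Adj n a u v = Shift n 1 u v ⊎ Shift n 1 v u ⊎ Shift n a u v ⊎ Shift n a v u

data Within (n a : ℕ) : ℕ → Fin n → Fin n → Set where
  here : ∀ {k u} → Within n a k u u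
  step : ∀ {k u w v} → Adj n a u w → Within n a k w v → Within n a (suc k) u v

-- f(v) ≤ e(v): some vertex w has d(v,w) ≥ f(v)
-- (for f(v) = 0 trivial; otherwise d(v,w) > f(v) - 1)
BelowEcc : (n a : ℕ) → (Fin n → ℕ) → Set
BelowEcc n a f = ∀ v → ∃[ w ] ((f v ≡ 0) ⊎ ¬ Within n a (f v ∸ 1) v w)

IndepCond : (n a : ℕ) → (Fin n → ℕ) → Set
IndepCond n a f = ∀ u v → ¬ (u ≡ v) → 0 < f u → 0 < f v →
  ¬ Within n a (f u ⊔ f v) u v

IndepBroadcast : (n a : ℕ) → (Fin n → ℕ) → Set
IndepBroadcast n a f = BelowEcc n a f × IndepCond n a f

cost : (n : ℕ) → (Fin n → ℕ) → ℕ
cost n f = sum (map f (allFin n))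

-- Write a = 2m and cut the cycle v₀ … v_{n-1} into k₁ consecutive blocks of
-- length a + 1 followed by k₂ blocks of length a - 1, and broadcast with
-- strength 1 from every vertex at an odd position inside its block. A block of
-- odd length 2j + 1 contributes j = ⌊(2j+1)/2⌋ such vertices, giving the cost.
-- No two of them are adjacent: a step of length 1 stays inside the block
-- (blocks end at an even position) and flips parity, while a step of length a
-- from an odd position crosses exactly one block boundary and, since the block
-- left has length a ± 1, lands at the neighbouring even position of the next
-- block. Wrapping around the cycle is handled by reading positions in two
-- copies of the block sequence.
module Submission where

open import Defs
open import Data.Nat using (ℕ; zero; suc; _+_; _*_; _∸_; _≤_; _<_; _/_; _⊔_; z≤n; s≤s; z<s; s<s; s≤s⁻¹; s<s⁻¹; _<?_; ⌊_/2⌋; parity)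
open import Data.Nat.Properties
open import Data.Nat.Divisibility using (_∣_; divides)
open import Data.Nat.DivMod using (m*n/n≡m; m/n≢0⇒n≤m)
open import Data.Nat.ListAction using (sum)
open import Data.Nat.ListAction.Properties using (sum-++)
open import Data.Parity.Base using (Parity; 0ℙ; 1ℙ; _⁻¹)
open import Data.Parity.Properties as ℙ using (⁻¹-involutive; suc-homo-⁻¹; *-homo-*)
open import Data.List using (List; []; _∷_; _++_; replicate; map; tabulate; applyUpTo)
open import Data.List.Properties using (map-tabulate; map-++; map-replicate; map-id)
open import Data.List.Relation.Unary.All as All using (All; []; _∷_)
open import Data.List.Relation.Unary.All.Properties using (++⁺; replicate⁺)
open import Data.Fin using (Fin; toℕ; punchIn) renaming (zero to fzero)
open import Data.Fin.Properties using (toℕ<n; punchInᵢ≢i)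
open import Data.Product using (∃-syntax; _×_; _,_)
open import Data.Sum using (_⊎_; inj₁; inj₂; [_,_]′)
open import Function using (_∘_; id)
open import Relation.Nullary using (¬_; yes; no; contradiction)
open import Relation.Binary.PropositionalEquality

Odd Even : ℕ → Set
Odd  x = parity x ≡ 1ℙ
Even x = parity x ≡ 0ℙ

parity-suc : ∀ x {p} → parity x ≡ p → parity (suc x) ≡ p ⁻¹
parity-suc x refl = trans (sym (⁻¹-involutive _)) (cong _⁻¹ (suc-homo-⁻¹ x))

parity-pred : ∀ x {p} → parity (suc x) ≡ p → parity x ≡ p ⁻¹
parity-pred x refl = sym (suc-homo-⁻¹ x)

odd⇒¬even : ∀ x → Odd x → ¬ Even x
odd⇒¬even x ox ex = contradiction (trans (sym ox) ex) λ ()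

odd<odd⇒suc< : ∀ {x L} → Odd x → Odd L → x < L → suc x < L
odd<odd⇒suc< {x} ox oL x<L with m≤n⇒m<n∨m≡n x<L
... | inj₁ 1+x<L = 1+x<L
... | inj₂ refl  = contradiction (parity-suc x ox) (odd⇒¬even (suc x) oL)

even-*2 : ∀ m → Even (m * 2)
even-*2 m = trans (*-homo-* m 2) (ℙ.*-zeroʳ (parity m))

⌊1+n*2/2⌋≡n : ∀ n → ⌊ suc (n * 2) /2⌋ ≡ n
⌊1+n*2/2⌋≡n zero    = refl
⌊1+n*2/2⌋≡n (suc n) = cong suc (⌊1+n*2/2⌋≡n n)

data Split (L : ℕ) : ℕ → Set where
  inside : ∀ {x} → x < L → Split L x
  beyond : ∀ y → Split L (L + y)

split : ∀ L x → Split L x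
split zero    x       = beyond x
split (suc L) zero    = inside z<s
split (suc L) (suc x) with split L x
... | inside x<L = inside (s<s x<L)
... | beyond y   = beyond y

-- The position of x inside its block when ℕ is cut into consecutive blocks of
-- the lengths ls; everything past the last block counts as one infinite block.
offset : List ℕ → ℕ → ℕ
offset []       x = x
offset (L ∷ ls) x with x <? L
... | yes _ = x
... | no  _ = offset ls (x ∸ L)

offset-inside : ∀ {L x} ls → x < L → offset (L ∷ ls) x ≡ x
offset-inside {L} {x} ls x<L with x <? L
... | yes _   = refl
... | no  x≮L = contradiction x<L x≮L

offset-beyond : ∀ L ls y → offset (L ∷ ls) (L + y) ≡ offset ls y
offset-beyond L ls y with L + y <? L
... | yes L+y<L = contradiction L+y<L (m+n≮m L y)
... | no  _     = cong (offset ls) (m+n∸m≡n L y)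

offset-++ˡ : ∀ ls ms {x} → x < sum ls → offset (ls ++ ms) x ≡ offset ls x
offset-++ˡ []       ms ()
offset-++ˡ (L ∷ ls) ms {x} x<Σ with split L x
... | inside x<L = trans (offset-inside (ls ++ ms) x<L) (sym (offset-inside ls x<L))
... | beyond y   = begin
  offset (L ∷ ls ++ ms) (L + y)  ≡⟨ offset-beyond L (ls ++ ms) y ⟩
  offset (ls ++ ms) y            ≡⟨ offset-++ˡ ls ms (+-cancelˡ-< L y (sum ls) x<Σ) ⟩
  offset ls y                    ≡⟨ offset-beyond L ls y ⟨
  offset (L ∷ ls) (L + y)        ∎
  where open ≡-Reasoning

offset-++ʳ : ∀ ls ms y → offset (ls ++ ms) (sum ls + y) ≡ offset ms y
offset-++ʳ []       ms y = refl
offset-++ʳ (L ∷ ls) ms y = begin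
  offset (L ∷ ls ++ ms) (L + sum ls + y)    ≡⟨ cong (offset (L ∷ ls ++ ms)) (+-assoc L (sum ls) y) ⟩
  offset (L ∷ ls ++ ms) (L + (sum ls + y))  ≡⟨ offset-beyond L (ls ++ ms) (sum ls + y) ⟩
  offset (ls ++ ms) (sum ls + y)            ≡⟨ offset-++ʳ ls ms y ⟩
  offset ms y                               ∎
  where open ≡-Reasoning

odd-offset-suc : ∀ ls → All Odd ls → ∀ x → Odd (offset ls x) → Even (offset ls (suc x))
odd-offset-suc []       _         x ox = parity-suc x ox
odd-offset-suc (L ∷ ls) (oL ∷ os) x ox with split L x
... | inside x<L = begin
  parity (offset (L ∷ ls) (suc x))  ≡⟨ cong parity (offset-inside ls (odd<odd⇒suc< ox′ oL x<L)) ⟩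
  parity (suc x)                    ≡⟨ parity-suc x ox′ ⟩
  0ℙ                                ∎
  where
    open ≡-Reasoning
    ox′ : Odd x
    ox′ = subst Odd (offset-inside ls x<L) ox
... | beyond y   = begin
  parity (offset (L ∷ ls) (suc (L + y)))  ≡⟨ cong (parity ∘ offset (L ∷ ls)) (+-suc L y) ⟨
  parity (offset (L ∷ ls) (L + suc y))    ≡⟨ cong parity (offset-beyond L ls (suc y)) ⟩
  parity (offset ls (suc y))              ≡⟨ odd-offset-suc ls os y (subst Odd (offset-beyond L ls y) ox) ⟩
  0ℙ                                      ∎
  where open ≡-Reasoning

data Block : ℕ → ℕ → Set where
  long  : ∀ {a} → Block a (suc a)
  short : ∀ {a} → Block (suc a) a

block-odd : ∀ {a L} → Even a → Block a L → Odd L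
block-odd {a} ea long  = parity-suc a ea
block-odd {L = L} ea short = parity-pred L ea

block-lower : ∀ {a L} → Block a L → a ≤ suc L
block-lower long  = m≤n⇒m≤1+n (n≤1+n _)
block-lower short = ≤-refl

block-upper : ∀ {a L} → Block a L → L ≤ suc a
block-upper long  = ≤-refl
block-upper short = m≤n⇒m≤1+n (n≤1+n _)

even-in-next-block : ∀ {L L′ y z} ls → z ≡ L + y → y < L′ → Even y →
  Even (offset (L ∷ L′ ∷ ls) z)
even-in-next-block {L} ls refl y<L′ ey =
  trans (cong parity (trans (offset-beyond L _ _) (offset-inside ls y<L′))) ey

odd-offset-crossing : ∀ {a L x} ls → Even a → Block a L → All (Block a) ls →
  x < L → Odd x → x + a < L + sum ls → Even (offset (L ∷ ls) (x + a))
odd-offset-crossing {x = zero} _ _ _ _ _ () _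
odd-offset-crossing {a} {L} {suc x} [] ea b [] _ _ x+a<L+0 =
  contradiction (subst (suc x + a <_) (+-identityʳ L) x+a<L+0)
                (≤⇒≯ (≤-trans (block-upper b) (+-monoˡ-≤ a (s≤s z≤n))))
odd-offset-crossing {a} {x = suc x} (L′ ∷ ls) ea long (b′ ∷ _) x<L ox _ =
  even-in-next-block ls (cong suc (+-comm x a)) x<L′ (parity-pred x ox)
  where
    x<L′ : x < L′
    x<L′ = s<s⁻¹ (<-≤-trans (s<s⁻¹ (odd<odd⇒suc< ox (block-odd {a} ea long) x<L)) (block-lower b′))
odd-offset-crossing {_} {L} {x} (L′ ∷ ls) ea short (b′ ∷ _) x<L ox _ =
  even-in-next-block ls (trans (+-comm x (suc L)) (sym (+-suc L x))) 1+x<L′ (parity-suc x ox)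
  where
    1+x<L′ : suc x < L′
    1+x<L′ = <-≤-trans (odd<odd⇒suc< ox (block-odd {suc L} ea short) x<L) (s≤s⁻¹ (block-lower b′))

OddOffsetsApart : ℕ → List ℕ → Set
OddOffsetsApart d ls = ∀ x → x + d < sum ls → Odd (offset ls x) → Even (offset ls (x + d))

odd-offsets-apart-1 : ∀ ls → All Odd ls → OddOffsetsApart 1 ls
odd-offsets-apart-1 ls os x _ ox = subst (Even ∘ offset ls) (+-comm 1 x) (odd-offset-suc ls os x ox)

odd-offsets-apart : ∀ {a} → Even a → ∀ ls → All (Block a) ls → OddOffsetsApart a ls
odd-offsets-apart ea []       []       _ ()    _
odd-offsets-apart ea (L ∷ ls) (b ∷ bs) x x+a<Σ ox with split L x
... | inside x<L = odd-offset-crossing ls ea b bs x<L (subst Odd (offset-inside ls x<L) ox) x+a<Σ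
odd-offsets-apart {a} ea (L ∷ ls) (b ∷ bs) _ L+y+a<Σ ox | beyond y = begin
  parity (offset (L ∷ ls) (L + y + a))    ≡⟨ cong (parity ∘ offset (L ∷ ls)) (+-assoc L y a) ⟩
  parity (offset (L ∷ ls) (L + (y + a)))  ≡⟨ cong parity (offset-beyond L ls (y + a)) ⟩
  parity (offset ls (y + a))              ≡⟨ odd-offsets-apart ea ls bs y y+a<Σ (subst Odd (offset-beyond L ls y) ox) ⟩
  0ℙ                                      ∎
  where
    open ≡-Reasoning
    y+a<Σ : y + a < sum ls
    y+a<Σ = +-cancelˡ-< L (y + a) (sum ls) (subst (_< L + sum ls) (+-assoc L y a) L+y+a<Σ)

odd-offset-cyclic-shift : ∀ ls {d} → OddOffsetsApart d (ls ++ ls) → (u v : Fin (sum ls)) →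
  Shift (sum ls) d u v → Odd (offset ls (toℕ u)) → Even (offset ls (toℕ v))
odd-offset-cyclic-shift ls {d} apart u v s ou =
  subst Even (lands s) (apart (toℕ u) (bound s) (subst Odd (sym (offset-++ˡ ls ls (toℕ<n u))) ou))
  where
    bound : Shift (sum ls) d u v → toℕ u + d < sum (ls ++ ls)
    bound (inj₁ e) = subst₂ _<_ (sym e) (sym (sum-++ ls ls)) (<-≤-trans (toℕ<n v) (m≤m+n (sum ls) (sum ls)))
    bound (inj₂ e) = subst₂ _<_ (sym e) (sym (sum-++ ls ls)) (+-monoˡ-< (sum ls) (toℕ<n v))
    lands : Shift (sum ls) d u v → offset (ls ++ ls) (toℕ u + d) ≡ offset ls (toℕ v)
    lands (inj₁ e) = trans (cong (offset (ls ++ ls)) e) (offset-++ˡ ls ls (toℕ<n v))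
    lands (inj₂ e) = trans (cong (offset (ls ++ ls)) (trans e (+-comm (toℕ v) (sum ls))))
                           (offset-++ʳ ls ls (toℕ v))

odd-offsets-nonadjacent : ∀ {a} → Even a → ∀ ls → All (Block a) ls → (u v : Fin (sum ls)) →
  Odd (offset ls (toℕ u)) → Odd (offset ls (toℕ v)) → ¬ Adj (sum ls) a u v
odd-offsets-nonadjacent {a} ea ls bs u v ou ov = λ
  { (inj₁ s)                → odd⇒¬even (offset ls (toℕ v)) ov (odd-offset-cyclic-shift ls apart₁ u v s ou)
  ; (inj₂ (inj₁ s))         → odd⇒¬even (offset ls (toℕ u)) ou (odd-offset-cyclic-shift ls apart₁ v u s ov)
  ; (inj₂ (inj₂ (inj₁ s)))  → odd⇒¬even (offset ls (toℕ v)) ov (odd-offset-cyclic-shift ls apartₐ u v s ou)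
  ; (inj₂ (inj₂ (inj₂ s)))  → odd⇒¬even (offset ls (toℕ u)) ou (odd-offset-cyclic-shift ls apartₐ v u s ov)
  }
  where
    blocks² : All (Block a) (ls ++ ls)
    blocks² = ++⁺ bs bs
    apart₁ : OddOffsetsApart 1 (ls ++ ls)
    apart₁ = odd-offsets-apart-1 (ls ++ ls) (All.map (block-odd ea) blocks²)
    apartₐ : OddOffsetsApart a (ls ++ ls)
    apartₐ = odd-offsets-apart ea (ls ++ ls) blocks²

bit : Parity → ℕ
bit 0ℙ = 0
bit 1ℙ = 1

bit≤1 : ∀ p → bit p ≤ 1
bit≤1 0ℙ = z≤n
bit≤1 1ℙ = ≤-refl

bit-pos : ∀ {p} → 0 < bit p → p ≡ 1ℙ
bit-pos {1ℙ} _ = refl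

within-zero : ∀ {n a} {u v : Fin n} → Within n a 0 u v → u ≡ v
within-zero here = refl

within-one : ∀ {n a} {u v : Fin n} → Within n a 1 u v → u ≡ v ⊎ Adj n a u v
within-one here            = inj₁ refl
within-one (step adj here) = inj₂ adj

≤1⇒belowEcc : ∀ {n a} (f : Fin n → ℕ) → 2 ≤ n → (∀ v → f v ≤ 1) → BelowEcc n a f
≤1⇒belowEcc {n} {a} f (s≤s (s≤s _)) f≤1 v =
  punchIn v fzero , inj₂ λ w → punchInᵢ≢i v fzero
    (sym (within-zero (subst (λ k → Within n a k v (punchIn v fzero)) (m≤n⇒m∸n≡0 (f≤1 v)) w)))

bit-independent : ∀ {n a} (m : Fin n → Parity) →
  (∀ u v → m u ≡ 1ℙ → m v ≡ 1ℙ → ¬ Adj n a u v) → IndepCond n a (bit ∘ m)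
bit-independent {n} {a} m nonadj u v u≢v mu>0 mv>0 w =
  [ u≢v , nonadj u v mu≡1 mv≡1 ]′
    (within-one (subst (λ k → Within n a k u v) (cong₂ (λ p q → bit p ⊔ bit q) mu≡1 mv≡1) w))
  where
    mu≡1 : m u ≡ 1ℙ
    mu≡1 = bit-pos mu>0
    mv≡1 : m v ≡ 1ℙ
    mv≡1 = bit-pos mv>0

oddOffsets : (ls : List ℕ) → Fin (sum ls) → ℕ
oddOffsets ls v = bit (parity (offset ls (toℕ v)))

oddOffsets-independent : ∀ {a} → Even a → ∀ ls → All (Block a) ls → 2 ≤ sum ls →
  IndepBroadcast (sum ls) a (oddOffsets ls)
oddOffsets-independent ea ls bs 2≤Σ =
  ≤1⇒belowEcc (oddOffsets ls) 2≤Σ (λ v → bit≤1 _) ,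
  bit-independent (λ v → parity (offset ls (toℕ v))) (odd-offsets-nonadjacent ea ls bs)

applyUpTo-+ : ∀ (f : ℕ → ℕ) m n → applyUpTo f (m + n) ≡ applyUpTo f m ++ applyUpTo (f ∘ (m +_)) n
applyUpTo-+ f zero    n = refl
applyUpTo-+ f (suc m) n = cong (f 0 ∷_) (applyUpTo-+ (f ∘ suc) m n)

applyUpTo-cong : ∀ {f g : ℕ → ℕ} n → (∀ {i} → i < n → f i ≡ g i) → applyUpTo f n ≡ applyUpTo g n
applyUpTo-cong zero    _   = refl
applyUpTo-cong (suc n) f≡g = cong₂ _∷_ (f≡g z<s) (applyUpTo-cong n (f≡g ∘ s<s))

tabulate-toℕ : ∀ {n} (f : ℕ → ℕ) → tabulate {n = n} (f ∘ toℕ) ≡ applyUpTo f n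
tabulate-toℕ {zero}  f = refl
tabulate-toℕ {suc n} f = cong (f 0 ∷_) (tabulate-toℕ (f ∘ suc))

cost-toℕ : ∀ n (f : ℕ → ℕ) → cost n (f ∘ toℕ) ≡ sum (applyUpTo f n)
cost-toℕ n f = cong sum (trans (map-tabulate id (f ∘ toℕ)) (tabulate-toℕ {n} f))

count-odd : ∀ L → sum (applyUpTo (bit ∘ parity) L) ≡ ⌊ L /2⌋
count-odd zero          = refl
count-odd (suc zero)    = refl
count-odd (suc (suc L)) = cong suc (count-odd L)

count-odd-offsets : ∀ ls → sum (applyUpTo (bit ∘ parity ∘ offset ls) (sum ls)) ≡ sum (map ⌊_/2⌋ ls)
count-odd-offsets []       = refl
count-odd-offsets (L ∷ ls) = begin
  sum (applyUpTo h (L + sum ls))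
    ≡⟨ cong sum (applyUpTo-+ h L (sum ls)) ⟩
  sum (applyUpTo h L ++ applyUpTo (h ∘ (L +_)) (sum ls))
    ≡⟨ sum-++ (applyUpTo h L) _ ⟩
  sum (applyUpTo h L) + sum (applyUpTo (h ∘ (L +_)) (sum ls))
    ≡⟨ cong₂ _+_ (cong sum (applyUpTo-cong L (cong (bit ∘ parity) ∘ offset-inside ls)))
                 (cong sum (applyUpTo-cong (sum ls) λ {i} _ → cong (bit ∘ parity) (offset-beyond L ls i))) ⟩
  sum (applyUpTo (bit ∘ parity) L) + sum (applyUpTo (bit ∘ parity ∘ offset ls) (sum ls))
    ≡⟨ cong₂ _+_ (count-odd L) (count-odd-offsets ls) ⟩
  ⌊ L /2⌋ + sum (map ⌊_/2⌋ ls)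
    ∎
  where
    open ≡-Reasoning
    h : ℕ → ℕ
    h = bit ∘ parity ∘ offset (L ∷ ls)

cost-oddOffsets : ∀ ls → cost (sum ls) (oddOffsets ls) ≡ sum (map ⌊_/2⌋ ls)
cost-oddOffsets ls = trans (cost-toℕ (sum ls) (bit ∘ parity ∘ offset ls)) (count-odd-offsets ls)

sum-replicate : ∀ k x → sum (replicate k x) ≡ k * x
sum-replicate zero    x = refl
sum-replicate (suc k) x = cong (x +_) (sum-replicate k x)

sum-map-replicate-++ : ∀ (g : ℕ → ℕ) k x l y →
  sum (map g (replicate k x ++ replicate l y)) ≡ k * g x + l * g y
sum-map-replicate-++ g k x l y = begin
  sum (map g (replicate k x ++ replicate l y))
    ≡⟨ cong sum (map-++ g (replicate k x) _) ⟩
  sum (map g (replicate k x) ++ map g (replicate l y))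
    ≡⟨ sum-++ (map g (replicate k x)) _ ⟩
  sum (map g (replicate k x)) + sum (map g (replicate l y))
    ≡⟨ cong₂ _+_ (cong sum (map-replicate g k x)) (cong sum (map-replicate g l y)) ⟩
  sum (replicate k (g x)) + sum (replicate l (g y))
    ≡⟨ cong₂ _+_ (sum-replicate k (g x)) (sum-replicate l (g y)) ⟩
  k * g x + l * g y
    ∎
  where open ≡-Reasoning

proposition13 : (n a k₁ k₂ : ℕ) →
    n ≡ k₁ * (a + 1) + k₂ * (a ∸ 1) →
    6 ≤ a → a ≤ n / 2 → 2 ∣ a →
    ∃[ f ] (IndepBroadcast n a f ×
    k₁ * (a / 2) + k₂ * (a / 2 ∸ 1) ≤ cost n f)
-- The construction works for every positive even a; 6 ≤ a only rules out a = 0.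
proposition13 n .(zero * 2) k₁ k₂ _ 6≤0 _ (divides zero refl) = contradiction 6≤0 λ ()
proposition13 n .(suc m * 2) k₁ k₂ n≡ _ a≤n/2 (divides (suc m) refl) =
  subst (λ N → ∃[ f ] (IndepBroadcast N a f × k₁ * (a / 2) + k₂ * (a / 2 ∸ 1) ≤ cost N f)) Σls≡n
    (oddOffsets ls , oddOffsets-independent (even-*2 (suc m)) ls blocks 2≤Σls , ≤-reflexive cost≡)
  where
    open ≡-Reasoning
    a : ℕ
    a = suc m * 2
    ls : List ℕ
    ls = replicate k₁ (suc a) ++ replicate k₂ (a ∸ 1)
    blocks : All (Block a) ls
    blocks = ++⁺ (replicate⁺ k₁ long) (replicate⁺ k₂ short)
    Σls≡n : sum ls ≡ n
    Σls≡n = begin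
      sum ls                             ≡⟨ cong sum (map-id ls) ⟨
      sum (map id ls)                    ≡⟨ sum-map-replicate-++ id k₁ (suc a) k₂ (a ∸ 1) ⟩
      k₁ * suc a + k₂ * (a ∸ 1)          ≡⟨ cong (λ b → k₁ * b + k₂ * (a ∸ 1)) (+-comm a 1) ⟨
      k₁ * (a + 1) + k₂ * (a ∸ 1)        ≡⟨ n≡ ⟨
      n                                  ∎
    2≤Σls : 2 ≤ sum ls
    2≤Σls = subst (2 ≤_) (sym Σls≡n) (m/n≢0⇒n≤m λ n/2≡0 → contradiction (subst (a ≤_) n/2≡0 a≤n/2) λ ())
    cost≡ : k₁ * (a / 2) + k₂ * (a / 2 ∸ 1) ≡ cost (sum ls) (oddOffsets ls)
    cost≡ = begin
      k₁ * (a / 2) + k₂ * (a / 2 ∸ 1)      ≡⟨ cong (λ h → k₁ * h + k₂ * (h ∸ 1)) (m*n/n≡m (suc m) 2) ⟩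
      k₁ * suc m + k₂ * m                  ≡⟨ cong (λ h → k₁ * suc h + k₂ * h) (⌊1+n*2/2⌋≡n m) ⟨
      k₁ * ⌊ suc a /2⌋ + k₂ * ⌊ a ∸ 1 /2⌋  ≡⟨ sum-map-replicate-++ ⌊_/2⌋ k₁ (suc a) k₂ (a ∸ 1) ⟨
      sum (map ⌊_/2⌋ ls)                   ≡⟨ cost-oddOffsets ls ⟨
      cost (sum ls) (oddOffsets ls)        ∎
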